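{- Let $k\ge 1$ and $n\ge 0$ be integers. There is a bijection between the set of permutations in $\mathcal{S}_n$ all of whose cycles have length at most $k$ and the set $\mathcal{S}_n(a\text{ - }a_1\cdots a_k)$ of permutations in $\mathcal{S}_n$ avoiding the partially ordered pattern $a\text{ - }a_1\cdots a_k$.
   Context: $\mathcal{S}_n$ is the set of permutations of $\{1,\dots,n\}$, written as words $\pi=\pi_1\pi_2\cdots\pi_n$. The pattern $a\text{ - }a_1\cdots a_k$ is built on the poset with elements $a,a_1,\dots,a_k$ whose only relations are $a<a_i$ for all $i$. An occurrence of $a\text{ - }a_1\cdots a_k$ in $\pi\in\mathcal{S}_n$ is a pair of indices $i<j$ with $j+k-1\le n$ such that $\pi_i<\pi_{j+t}$ for all $t=0,1,\dots,k-1$ (i.e. a letter followed, somewhere later, by $k$ consecutive letters all larger than it). $\pi$ avoids the pattern if it has no occurrence. -}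

module Defs where

open import Data.Nat using (ℕ; zero; suc; _+_; _≤_; _<_)
open import Data.Fin using (Fin; toℕ)
open import Data.Vec using (Vec; lookup)
open import Data.Product using (Σ; ∃; _×_; _,_)
open import Function.Definitions using (Injective)
open import Relation.Binary.PropositionalEquality using (_≡_)
open import Relation.Nullary using (¬_)

-- A permutation of {1..n} (0-indexed as Fin n) in one-line notation:
-- the word π₁…πₙ as a vector whose entries are pairwise distinct.
IsPerm : ∀ {n} → Vec (Fin n) n → Set
IsPerm {n} w = Injective _≡_ _≡_ (lookup w)

Perm : ℕ → Set
Perm n = Σ (Vec (Fin n) n) IsPerm

iter : ∀ {n} → Vec (Fin n) n → ℕ → Fin n → Fin n
iter w zero    i = i
iter w (suc m) i = lookup w (iter w m i)

-- the cycle containing i has length ≤ k : some m with 1 ≤ m ≤ k and π^m(i) = i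
-- (the length of the cycle of i is the least such positive m)
CycleLen≤ : ∀ {n} → ℕ → Vec (Fin n) n → Fin n → Set
CycleLen≤ k w i = ∃ λ m → 1 ≤ m × m ≤ k × iter w m i ≡ i

AllCycles≤ : ∀ {n} → ℕ → Perm n → Set
AllCycles≤ {n} k (w , _) = (i : Fin n) → CycleLen≤ k w i

-- occurrence of a-a₁⋯a_k (0-indexed positions i < j, j + k ≤ n):
-- π_i < π_{j+t} for all t < k
Occurrence : ∀ {n} → ℕ → Vec (Fin n) n → Set
Occurrence {n} k w =
  Σ (Fin n) λ i → Σ ℕ λ j → toℕ i < j × j + k ≤ n ×
    ((t : ℕ) (lt : j + t < n) → t < k →
       toℕ (lookup w i) < toℕ (lookup w (Data.Fin.fromℕ< lt)))

Avoids : ∀ {n} → ℕ → Perm n → Set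
Avoids k (w , _) = ¬ Occurrence k w

CycleBounded : ℕ → ℕ → Set
CycleBounded k n = Σ (Perm n) (AllCycles≤ k)

AvoidingPerms : ℕ → ℕ → Set
AvoidingPerms k n = Σ (Perm n) (Avoids k)

-- Sets of permutations as setoids: two elements are equal iff their
-- underlying words (vectors) are equal; proof components are irrelevant.
open import Relation.Binary.Bundles using (Setoid)
import Relation.Binary.Construct.On as On
import Relation.Binary.PropositionalEquality as PE

word : ∀ {n} {P : Perm n → Set} → Σ (Perm n) P → Vec (Fin n) n
word ((w , _) , _) = w

CycleBoundedSetoid : ℕ → ℕ → Setoid _ _
CycleBoundedSetoid k n = On.setoid {B = CycleBounded k n} (PE.setoid (Vec (Fin n) n)) word

AvoidingSetoid : ℕ → ℕ → Setoid _ _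
AvoidingSetoid k n = On.setoid {B = AvoidingPerms k n} (PE.setoid (Vec (Fin n) n)) word

{-# OPTIONS --safe #-}
module Submission where

-- Foata's fundamental transformation.  Write a permutation as its cycles, each
-- starting at its least element, list the cycles by decreasing least element and
-- erase the parentheses.  The cycle minima are then exactly the left-to-right
-- minima of the word, so the cycles are recovered by cutting the word in front of
-- each left-to-right minimum.  A cycle has at most k elements iff its block has,
-- and a word has a block longer than k iff some letter is followed, later, by k
-- consecutive larger letters: the first letter of a long block followed by the k
-- letters after it is such an occurrence, and conversely k letters larger than an
-- earlier one contain no left-to-right minimum, so they lie in a single block
-- together with the letter in front of them.

open import Defs
open import Data.Nat using (ℕ; _≥_)
open import Function.Bundles using (Bijection)

open import Data.Nat as ℕ using (zero; suc; _+_; _*_; _∸_; _≤_; _<_; z≤n; s≤s; _<?_; _≟_)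
open import Data.Nat.Properties
open import Data.Fin as Fin using (Fin; toℕ; fromℕ<)
import Data.Fin.Properties as Fin
open import Data.Fin.Subset using (Subset; _∈_; _⊂_; ∣_∣)
open import Data.Fin.Subset.Properties using (∈⊤; ∣⊤∣≡n; p⊂q⇒∣p∣<∣q∣)
open import Data.Bool.Properties using (T-≡)
open import Data.Vec using (Vec; lookup; tabulate)
open import Data.Vec.Properties using (lookup∘tabulate; tabulate∘lookup; tabulate-cong; []=⇒lookup; lookup⇒[]=)
open import Data.Product using (∃; _×_; _,_)
open import Data.Sum using (_⊎_; inj₁; inj₂)
open import Function.Base using (_∘_)
open import Function.Bundles using (Equivalence)
open import Function.Definitions using (Injective)
open import Relation.Nullary using (¬_; Dec; yes; no)
open import Relation.Nullary.Decidable using (isYes; fromWitness; toWitness; _×-dec_)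
open import Relation.Nullary.Negation using (contradiction)
open import Relation.Binary.Definitions using (tri<; tri≈; tri>)
open import Relation.Binary.PropositionalEquality
import Function.Endo.Propositional
open module Endo {a} {A : Set a} = Function.Endo.Propositional A using (_^_; ^-homo)

private variable
  A : Set

-- Iteration and orbits

^-+ : (f : A → A) (m k : ℕ) (x : A) → (f ^ (m + k)) x ≡ (f ^ m) ((f ^ k) x)
^-+ f m k x = cong-app (^-homo f m k) x

^-injective : {f : A → A} → Injective _≡_ _≡_ f → ∀ m → Injective _≡_ _≡_ (f ^ m)
^-injective f-injective zero    eq = eq
^-injective f-injective (suc m) eq = ^-injective f-injective m (f-injective eq)

^-inverse : {f g : A → A} → (∀ y → f (g y) ≡ y) → ∀ m y → (f ^ m) ((g ^ m) y) ≡ y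
^-inverse         fg zero    y = refl
^-inverse {f = f} {g} fg (suc m) y = begin
  (f ^ suc m) ((g ^ suc m) y)     ≡⟨ cong (λ t → (f ^ t) ((g ^ suc m) y)) (+-comm 1 m) ⟩
  (f ^ (m + 1)) (g ((g ^ m) y))   ≡⟨ ^-+ f m 1 _ ⟩
  (f ^ m) (f (g ((g ^ m) y)))     ≡⟨ cong (f ^ m) (fg _) ⟩
  (f ^ m) ((g ^ m) y)             ≡⟨ ^-inverse fg m y ⟩
  y                               ∎
  where open ≡-Reasoning

ReturnsWithin : ℕ → (A → A) → A → Set
ReturnsWithin k f x = ∃ λ ℓ → 1 ≤ ℓ × ℓ ≤ k × (f ^ ℓ) x ≡ x

Reaches : (A → A) → A → A → Set
Reaches f x y = ∃ λ m → (f ^ m) x ≡ y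

reaches-trans : {f : A → A} {x y z : A} → Reaches f x y → Reaches f y z → Reaches f x z
reaches-trans {f = f} {x} (m , refl) (m′ , refl) = m′ + m , ^-+ f m′ m x

returnsWithin-pigeonhole : {f : A → A} → Injective _≡_ _≡_ f → ∀ {k} x (idx : ℕ → Fin k) →
                           (∀ i j → idx i ≡ idx j → (f ^ i) x ≡ (f ^ j) x) → ReturnsWithin k f x
returnsWithin-pigeonhole {f = f} f-injective {k} x idx idx-faithful
  with i , j , i<j , same ← Fin.pigeonhole (n<1+n k) (idx ∘ toℕ) =
    ℓ , m<n⇒0<n∸m i<j , ≤-trans (m∸n≤m (toℕ j) (toℕ i)) (≤-pred (Fin.toℕ<n j)) , returns
  where
  ℓ = toℕ j ∸ toℕ i
  returns : (f ^ ℓ) x ≡ x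
  returns = ^-injective f-injective (toℕ i) (begin
    (f ^ toℕ i) ((f ^ ℓ) x)   ≡⟨ ^-+ f (toℕ i) ℓ x ⟨
    (f ^ (toℕ i + ℓ)) x       ≡⟨ cong (λ t → (f ^ t) x) (m+[n∸m]≡n (<⇒≤ i<j)) ⟩
    (f ^ toℕ j) x             ≡⟨ idx-faithful (toℕ i) (toℕ j) same ⟨
    (f ^ toℕ i) x             ∎)
    where open ≡-Reasoning

module _ {f : A → A} {x : A} {ℓ : ℕ} (1≤ℓ : 1 ≤ ℓ) (returns : (f ^ ℓ) x ≡ x) where

  ^-reduce : ∀ m → ∃ λ j → j < ℓ × (f ^ m) x ≡ (f ^ j) x
  ^-reduce zero = 0 , 1≤ℓ , refl
  ^-reduce (suc m) with j , j<ℓ , eq ← ^-reduce m with m≤n⇒m<n∨m≡n j<ℓ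
  ... | inj₁ 1+j<ℓ = suc j , 1+j<ℓ , cong f eq
  ... | inj₂ refl  = 0 , 1≤ℓ , trans (cong f eq) returns

  periodic⇒reaches-sym : ∀ {y} → Reaches f x y → Reaches f y x
  periodic⇒reaches-sym (m , refl) with j , j<ℓ , eq ← ^-reduce m = ℓ ∸ j , (begin
    (f ^ (ℓ ∸ j)) ((f ^ m) x)   ≡⟨ cong (f ^ (ℓ ∸ j)) eq ⟩
    (f ^ (ℓ ∸ j)) ((f ^ j) x)   ≡⟨ ^-+ f (ℓ ∸ j) j x ⟨
    (f ^ (ℓ ∸ j + j)) x         ≡⟨ cong (λ t → (f ^ t) x) (m∸n+n≡m (<⇒≤ j<ℓ)) ⟩
    (f ^ ℓ) x                   ≡⟨ returns ⟩
    x                           ∎)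
    where open ≡-Reasoning

-- Injective endofunctions of Fin n

opaque
  inverse : ∀ {n} → (Fin n → Fin n) → Fin n → Fin n
  inverse f y with Fin.any? (λ x → f x Fin.≟ y)
  ... | yes (x , _) = x
  ... | no _        = y

  inverseʳ : ∀ {n} {f : Fin n → Fin n} → Injective _≡_ _≡_ f → ∀ y → f (inverse f y) ≡ y
  inverseʳ {f = f} f-injective y with Fin.any? (λ x → f x Fin.≟ y)
  ... | yes (_ , fx≡y) = fx≡y
  inverseʳ {suc m} {f} f-injective y | no y∉image =
    contradiction (Fin.injective⇒≤ squeezed-injective) (<-irrefl refl)
    where
    -- without y in its image, f would inject Fin (suc m) into Fin m
    y≢f : ∀ x → y ≢ f x
    y≢f x y≡fx = y∉image (x , sym y≡fx)
    squeezed : Fin (suc m) → Fin m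
    squeezed x = Fin.punchOut (y≢f x)
    squeezed-injective : Injective _≡_ _≡_ squeezed
    squeezed-injective {a} {b} = f-injective ∘ Fin.punchOut-injective (y≢f a) (y≢f b)

module _ {n} {f : Fin n → Fin n} (f-injective : Injective _≡_ _≡_ f) where

  inverseˡ : ∀ x → inverse f (f x) ≡ x
  inverseˡ x = f-injective (inverseʳ f-injective (f x))

  inverse-injective : Injective _≡_ _≡_ (inverse f)
  inverse-injective {y} {z} eq = begin
    y                  ≡⟨ inverseʳ f-injective y ⟨
    f (inverse f y)    ≡⟨ cong f eq ⟩
    f (inverse f z)    ≡⟨ inverseʳ f-injective z ⟩
    z                  ∎
    where open ≡-Reasoning

  returnsWithin-size : ∀ x → ReturnsWithin n f x
  returnsWithin-size x = returnsWithin-pigeonhole f-injective x (λ i → (f ^ i) x) (λ _ _ eq → eq)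

  reaches-symmetric : ∀ {x y} → Reaches f x y → Reaches f y x
  reaches-symmetric {x} with _ , 1≤ℓ , _ , returns ← returnsWithin-size x =
    periodic⇒reaches-sym 1≤ℓ returns

increasing⇒≤ : ∀ {n} {g : Fin n → Fin n} → (∀ {i j} → i Fin.< j → g i Fin.< g j) → ∀ i → i Fin.≤ g i
increasing⇒≤ {g = g} g-increasing i = go (toℕ i) i refl
  where
  go : ∀ m i → toℕ i ≡ m → m ≤ toℕ (g i)
  go zero    i _      = z≤n
  go (suc m) i i≡1+m = <-≤-trans (s≤s (go m i′ (Fin.toℕ-fromℕ< _)))
                                 (g-increasing (subst (toℕ i′ <_) (sym i≡1+m) i′<1+m))
    where
    i′ = fromℕ< (<-trans (n<1+n m) (subst (_< _) i≡1+m (Fin.toℕ<n i)))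
    i′<1+m : toℕ i′ < suc m
    i′<1+m = subst (_< suc m) (sym (Fin.toℕ-fromℕ< _)) (n<1+n m)

module _ {n} {f : Fin n → Fin n} (f-increasing : ∀ {i j} → i Fin.< j → f i Fin.< f j) where

  private
    f-injective : Injective _≡_ _≡_ f
    f-injective {i} {j} eq with Fin.<-cmp i j
    ... | tri< i<j _ _ = contradiction eq (Fin.<⇒≢ (f-increasing i<j))
    ... | tri≈ _ i≡j _ = i≡j
    ... | tri> _ _ j<i = contradiction (sym eq) (Fin.<⇒≢ (f-increasing j<i))

    f-monotone : ∀ {i j} → i Fin.≤ j → f i Fin.≤ f j
    f-monotone i≤j with m≤n⇒m<n∨m≡n i≤j
    ... | inj₁ i<j = <⇒≤ (f-increasing i<j)
    ... | inj₂ i≡j = ≤-reflexive (cong (toℕ ∘ f) (Fin.toℕ-injective i≡j))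

    f⁻¹-increasing : ∀ {i j} → i Fin.< j → inverse f i Fin.< inverse f j
    f⁻¹-increasing {i} {j} i<j = ≰⇒> λ f⁻¹j≤f⁻¹i → <⇒≱ i<j (subst₂ Fin._≤_
      (inverseʳ f-injective j) (inverseʳ f-injective i) (f-monotone f⁻¹j≤f⁻¹i))

  increasing⇒≡id : ∀ i → f i ≡ i
  increasing⇒≡id i = Fin.≤-antisym (subst (f i Fin.≤_) (inverseʳ f-injective i)
                                          (f-monotone (increasing⇒≤ f⁻¹-increasing i)))
                                    (increasing⇒≤ f-increasing i)

-- First minimum of a sequence

opaque
  argmin : (ℕ → ℕ) → ℕ → ℕ
  argmin f zero = zero
  argmin f (suc p) with f (suc p) <? f (argmin f p)
  ... | yes _ = suc p
  ... | no _  = argmin f p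

  argmin-≤ : ∀ (f : ℕ → ℕ) p → argmin f p ≤ p
  argmin-≤ f zero = z≤n
  argmin-≤ f (suc p) with f (suc p) <? f (argmin f p)
  ... | yes _ = ≤-refl
  ... | no _  = m≤n⇒m≤1+n (argmin-≤ f p)

  argmin-minimal : ∀ (f : ℕ → ℕ) {p q} → q ≤ p → f (argmin f p) ≤ f q
  argmin-minimal f {zero} z≤n = ≤-refl
  argmin-minimal f {suc p} q≤1+p with f (suc p) <? f (argmin f p) | m≤n⇒m<n∨m≡n q≤1+p
  ... | yes new | inj₁ q<1+p = <⇒≤ (<-≤-trans new (argmin-minimal f (≤-pred q<1+p)))
  ... | yes _   | inj₂ refl  = ≤-refl
  ... | no _    | inj₁ q<1+p = argmin-minimal f (≤-pred q<1+p)
  ... | no old  | inj₂ refl  = ≮⇒≥ old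

  argmin-first : ∀ (f : ℕ → ℕ) {p q} → q < argmin f p → f (argmin f p) < f q
  argmin-first f {suc p} q<argmin with f (suc p) <? f (argmin f p)
  ... | yes new = <-≤-trans new (argmin-minimal f (≤-pred q<argmin))
  ... | no _    = argmin-first f {p} q<argmin

argmin-unique : ∀ {f : ℕ → ℕ} → Injective _≡_ _≡_ f →
                ∀ {p s} → s ≤ p → (∀ {q} → q ≤ p → f s ≤ f q) → argmin f p ≡ s
argmin-unique {f} f-injective s≤p s-minimal =
  f-injective (≤-antisym (argmin-minimal f s≤p) (s-minimal (argmin-≤ f _)))

-- Listing Fin n by an injective key

module _ {n} (key : Fin n → ℕ) where

  smaller : Fin n → Subset n
  smaller v = tabulate (λ u → isYes (key u <? key v))

  ∈-smaller : ∀ {u v} → key u < key v → u ∈ smaller v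
  ∈-smaller {u} lt = lookup⇒[]= u _ (trans (lookup∘tabulate _ u) (Equivalence.to T-≡ (fromWitness lt)))

  ∈-smaller⁻ : ∀ {u v} → u ∈ smaller v → key u < key v
  ∈-smaller⁻ {u} {v} u∈ = toWitness {a? = key u <? key v}
    (Equivalence.from T-≡ (trans (sym (lookup∘tabulate _ u)) ([]=⇒lookup u∈)))

  smaller-⊂ : ∀ {u v} → key u < key v → smaller u ⊂ smaller v
  smaller-⊂ {u} lt =
    (λ w∈ → ∈-smaller (<-trans (∈-smaller⁻ w∈) lt)) , u , ∈-smaller lt , <-irrefl refl ∘ ∈-smaller⁻

  rank : Fin n → Fin n
  rank v = fromℕ< (subst (∣ smaller v ∣ <_) (∣⊤∣≡n n)
    (p⊂q⇒∣p∣<∣q∣ ((λ _ → ∈⊤) , v , ∈⊤ , <-irrefl refl ∘ ∈-smaller⁻)))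

  listing : Fin n → Fin n
  listing = inverse rank

module Ranking {n} {key : Fin n → ℕ} (key-injective : Injective _≡_ _≡_ key) where

  rank-< : ∀ {u v} → key u < key v → rank key u Fin.< rank key v
  rank-< lt = subst₂ _<_ (sym (Fin.toℕ-fromℕ< _)) (sym (Fin.toℕ-fromℕ< _))
                         (p⊂q⇒∣p∣<∣q∣ (smaller-⊂ key lt))

  rank-<⁻ : ∀ {u v} → rank key u Fin.< rank key v → key u < key v
  rank-<⁻ {u} {v} rank-lt with <-cmp (key u) (key v)
  ... | tri< lt _ _ = lt
  ... | tri≈ _ eq _ = contradiction (cong (rank key) (key-injective eq)) (Fin.<⇒≢ rank-lt)
  ... | tri> _ _ gt = contradiction (rank-< gt) (<⇒≯ rank-lt)

  rank-≤ : ∀ {u v} → key u ≤ key v → rank key u Fin.≤ rank key v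
  rank-≤ le with m≤n⇒m<n∨m≡n le
  ... | inj₁ lt = <⇒≤ (rank-< lt)
  ... | inj₂ eq = ≤-reflexive (cong (toℕ ∘ rank key) (key-injective eq))

  rank-injective : Injective _≡_ _≡_ (rank key)
  rank-injective {u} {v} eq with <-cmp (key u) (key v)
  ... | tri< lt _ _  = contradiction eq (Fin.<⇒≢ (rank-< lt))
  ... | tri≈ _ eq′ _ = key-injective eq′
  ... | tri> _ _ gt  = contradiction (sym eq) (Fin.<⇒≢ (rank-< gt))

  rank-listing : ∀ p → rank key (listing key p) ≡ p
  rank-listing = inverseʳ rank-injective

  listing-rank : ∀ v → listing key (rank key v) ≡ v
  listing-rank = inverseˡ rank-injective

  listing-increasing : ∀ {i j} → i Fin.< j → key (listing key i) < key (listing key j)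
  listing-increasing i<j = rank-<⁻ (subst₂ Fin._<_ (sym (rank-listing _)) (sym (rank-listing _)) i<j)

  listing-monotone : ∀ {i j} → i Fin.≤ j → key (listing key i) ≤ key (listing key j)
  listing-monotone i≤j with m≤n⇒m<n∨m≡n i≤j
  ... | inj₁ i<j = <⇒≤ (listing-increasing i<j)
  ... | inj₂ i≡j = ≤-reflexive (cong (key ∘ listing key) (Fin.toℕ-injective i≡j))

  increasing⇒≡listing : (w : Fin n → Fin n) → (∀ {i j} → i Fin.< j → key (w i) < key (w j)) →
                        ∀ i → w i ≡ listing key i
  increasing⇒≡listing w w-increasing i = begin
    w i                          ≡⟨ listing-rank (w i) ⟨
    listing key (rank key (w i)) ≡⟨ cong (listing key) (increasing⇒≡id (rank-< ∘ w-increasing) i) ⟩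
    listing key i                ∎
    where open ≡-Reasoning

  rank-suc : ∀ {u v} → key v ≡ suc (key u) → toℕ (rank key v) ≡ suc (toℕ (rank key u))
  rank-suc {u} {v} key-suc = ≤-antisym (≮⇒≥ gap) (rank-< u<v)
    where
    u<v : key u < key v
    u<v = subst (key u <_) (sym key-suc) (n<1+n (key u))
    gap : ¬ suc (toℕ (rank key u)) < toℕ (rank key v)
    gap between = <⇒≱ (rank-<⁻ z<v) (subst (_≤ key z) (sym key-suc) (rank-<⁻ u<z))
      where
      z = listing key (fromℕ< (<-trans between (Fin.toℕ<n (rank key v))))
      rank-z : toℕ (rank key z) ≡ suc (toℕ (rank key u))
      rank-z = trans (cong toℕ (rank-listing _)) (Fin.toℕ-fromℕ< _)
      u<z : rank key u Fin.< rank key z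
      u<z = subst (toℕ (rank key u) <_) (sym rank-z) (n<1+n _)
      z<v : rank key z Fin.< rank key v
      z<v = subst (_< toℕ (rank key v)) (sym rank-z) between

-- Cycle minima

module _ {n} (σ : Fin n → Fin n) where

  -- Walking backwards from v, the least element of its cycle is first met after offset v steps.
  offset : Fin n → ℕ
  offset v = argmin (λ j → toℕ ((inverse σ ^ j) v)) n

  cycleMin : Fin n → Fin n
  cycleMin v = (inverse σ ^ offset v) v

  -- Cycles by decreasing minimum, then offset from the minimum; injective as offset ≤ n.
  cycleKey : Fin n → ℕ
  cycleKey v = (n ∸ toℕ (cycleMin v)) * suc n + offset v

module CycleStructure {n} {σ : Fin n → Fin n} (σ-injective : Injective _≡_ _≡_ σ) where

  private
    σ⁻¹ = inverse σ
    minimised : Fin n → ℕ → ℕ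
    minimised v j = toℕ ((σ⁻¹ ^ j) v)

  σ^offset : ∀ v → (σ ^ offset σ v) (cycleMin σ v) ≡ v
  σ^offset v = ^-inverse (inverseʳ σ-injective) (offset σ v) v

  cycleMin-reachable : ∀ v → Reaches σ v (cycleMin σ v)
  cycleMin-reachable v = reaches-symmetric σ-injective (offset σ v , σ^offset v)

  cycleMin-least : ∀ {v y} → Reaches σ v y → cycleMin σ v Fin.≤ y
  cycleMin-least {v} {y} v↝y with m , σ^m[y]≡v ← reaches-symmetric σ-injective v↝y
    with _ , 1≤ℓ , ℓ≤n , returns ← returnsWithin-size (inverse-injective σ-injective) v
    with j , j<ℓ , same ← ^-reduce 1≤ℓ returns m = begin
      minimised v (offset σ v)    ≤⟨ argmin-minimal (minimised v) {n} (<⇒≤ (<-≤-trans j<ℓ ℓ≤n)) ⟩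
      minimised v j               ≡⟨ cong toℕ (sym same) ⟩
      toℕ ((σ⁻¹ ^ m) v)           ≡⟨ cong (toℕ ∘ (σ⁻¹ ^ m)) (sym σ^m[y]≡v) ⟩
      toℕ ((σ⁻¹ ^ m) ((σ ^ m) y)) ≡⟨ cong toℕ (^-inverse (inverseˡ σ-injective) m y) ⟩
      toℕ y                       ∎
    where open ≤-Reasoning

  offset-≤ : ∀ v → offset σ v ≤ n
  offset-≤ v = argmin-≤ (minimised v) n

  offset-first : ∀ {v j} → j < offset σ v → (σ ^ j) (cycleMin σ v) ≢ v
  offset-first {v} {j} j<offset σ^j[min]≡v =
    <-irrefl (cong toℕ earlier) (argmin-first (minimised v) {n} j<offset)
    where
    earlier : cycleMin σ v ≡ (σ⁻¹ ^ j) v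
    earlier = trans (sym (^-inverse (inverseˡ σ-injective) j (cycleMin σ v))) (cong (σ⁻¹ ^ j) σ^j[min]≡v)

  cycleMin-char : ∀ {v x} → Reaches σ v x → (∀ {y} → Reaches σ v y → x Fin.≤ y) → cycleMin σ v ≡ x
  cycleMin-char v↝x x-least = Fin.≤-antisym (cycleMin-least v↝x) (x-least (cycleMin-reachable _))

  cycleMin-cong : ∀ {u v} → Reaches σ u v → cycleMin σ u ≡ cycleMin σ v
  cycleMin-cong u↝v = sym (cycleMin-char
    (reaches-trans (reaches-symmetric σ-injective u↝v) (cycleMin-reachable _))
    (cycleMin-least ∘ reaches-trans u↝v))

  cycleMin-σ : ∀ v → cycleMin σ (σ v) ≡ cycleMin σ v
  cycleMin-σ v = sym (cycleMin-cong (1 , refl))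

  cycleMin-idem : ∀ v → cycleMin σ (cycleMin σ v) ≡ cycleMin σ v
  cycleMin-idem v = sym (cycleMin-cong (cycleMin-reachable v))

  cycleMin-≤ : ∀ v → cycleMin σ v Fin.≤ v
  cycleMin-≤ v = cycleMin-least (0 , refl)

  offset-char : ∀ {v a} → (σ ^ a) (cycleMin σ v) ≡ v → (∀ {j} → j < a → (σ ^ j) (cycleMin σ v) ≢ v) →
                offset σ v ≡ a
  offset-char {v} {a} σ^a[min]≡v a-first with <-cmp (offset σ v) a
  ... | tri< lt _ _ = contradiction (σ^offset v) (a-first lt)
  ... | tri≈ _ eq _ = eq
  ... | tri> _ _ gt = contradiction σ^a[min]≡v (offset-first gt)

  offset-cycleMin : ∀ v → offset σ (cycleMin σ v) ≡ 0
  offset-cycleMin v = offset-char (cycleMin-idem v) λ ()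

  offset-σ : ∀ {v} → σ v ≢ cycleMin σ v → offset σ (σ v) ≡ suc (offset σ v)
  offset-σ {v} σv≢min = offset-char reaches-σv earlier-≢
    where
    reaches-σv : (σ ^ suc (offset σ v)) (cycleMin σ (σ v)) ≡ σ v
    reaches-σv = subst (λ m → σ ((σ ^ offset σ v) m) ≡ σ v) (sym (cycleMin-σ v)) (cong σ (σ^offset v))
    earlier-≢ : ∀ {j} → j < suc (offset σ v) → (σ ^ j) (cycleMin σ (σ v)) ≢ σ v
    earlier-≢ {zero}  _           eq = σv≢min (sym (trans (sym (cycleMin-σ v)) eq))
    earlier-≢ {suc j} (s≤s j<off) eq =
      offset-first j<off (subst (λ m → (σ ^ j) m ≡ v) (cycleMin-σ v) (σ-injective eq))

  offset-pred : ∀ {v} → 0 < offset σ v →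
                ∃ λ u → σ u ≡ v × cycleMin σ u ≡ cycleMin σ v × offset σ v ≡ suc (offset σ u)
  offset-pred {v} 0<offset =
    u , σu≡v , same-cycle , trans offset≡1+a (cong suc (sym (offset-char σ^a[min]≡u earlier-≢)))
    where
    a = ℕ.pred (offset σ v)
    offset≡1+a : offset σ v ≡ suc a
    offset≡1+a = sym (suc-pred (offset σ v) {{ℕ.>-nonZero 0<offset}})
    u = (σ ^ a) (cycleMin σ v)
    σu≡v : σ u ≡ v
    σu≡v = subst (λ j → (σ ^ j) (cycleMin σ v) ≡ v) offset≡1+a (σ^offset v)
    same-cycle : cycleMin σ u ≡ cycleMin σ v
    same-cycle = trans (sym (cycleMin-cong (a , refl))) (cycleMin-idem v)
    σ^a[min]≡u : (σ ^ a) (cycleMin σ u) ≡ u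
    σ^a[min]≡u = cong (σ ^ a) same-cycle
    earlier-≢ : ∀ {j} → j < a → (σ ^ j) (cycleMin σ u) ≢ u
    earlier-≢ {j} j<a eq = offset-first (subst (suc j <_) (sym offset≡1+a) (s≤s j<a))
      (trans (cong (σ ∘ (σ ^ j)) (sym same-cycle)) (trans (cong σ eq) σu≡v))

  cycleKey-cycleMin : ∀ {u v} → cycleMin σ v Fin.< cycleMin σ u → cycleKey σ u < cycleKey σ v
  cycleKey-cycleMin {u} {v} lt = begin-strict
    a * suc n + offset σ u  <⟨ +-monoʳ-< (a * suc n) (s≤s (offset-≤ u)) ⟩
    a * suc n + suc n       ≡⟨ +-comm (a * suc n) (suc n) ⟩
    suc a * suc n           ≤⟨ *-monoˡ-≤ (suc n) (∸-monoʳ-< lt (<⇒≤ (Fin.toℕ<n (cycleMin σ u)))) ⟩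
    b * suc n               ≤⟨ m≤m+n (b * suc n) (offset σ v) ⟩
    b * suc n + offset σ v  ∎
    where
    open ≤-Reasoning
    a = n ∸ toℕ (cycleMin σ u)
    b = n ∸ toℕ (cycleMin σ v)

  cycleKey-offset : ∀ {u v} → cycleMin σ u ≡ cycleMin σ v → offset σ u < offset σ v →
                    cycleKey σ u < cycleKey σ v
  cycleKey-offset {u} {v} same-cycle lt =
    subst (λ m → (n ∸ toℕ m) * suc n + offset σ u < cycleKey σ v) (sym same-cycle) (+-monoʳ-< _ lt)

  cycleKey-suc : ∀ {u v} → cycleMin σ u ≡ cycleMin σ v → offset σ v ≡ suc (offset σ u) →
                 cycleKey σ v ≡ suc (cycleKey σ u)
  cycleKey-suc {u} {v} same-cycle offset≡ = begin
    (n ∸ toℕ (cycleMin σ v)) * suc n + offset σ v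
      ≡⟨ cong₂ (λ m o → (n ∸ toℕ m) * suc n + o) (sym same-cycle) offset≡ ⟩
    (n ∸ toℕ (cycleMin σ u)) * suc n + suc (offset σ u)  ≡⟨ +-suc _ (offset σ u) ⟩
    suc (cycleKey σ u)                                  ∎
    where open ≡-Reasoning

  cycleKey-<⁻ : ∀ {u v} → cycleKey σ u < cycleKey σ v →
                cycleMin σ v Fin.< cycleMin σ u ⊎ (cycleMin σ u ≡ cycleMin σ v × offset σ u < offset σ v)
  cycleKey-<⁻ {u} {v} lt with Fin.<-cmp (cycleMin σ v) (cycleMin σ u)
  ... | tri< v<u _ _ = inj₁ v<u
  ... | tri> _ _ u<v = contradiction (cycleKey-cycleMin u<v) (<⇒≯ lt)
  ... | tri≈ _ eq _  = inj₂ (sym eq , +-cancelˡ-< _ (offset σ u) (offset σ v)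
                              (subst (λ m → (n ∸ toℕ m) * suc n + offset σ u < cycleKey σ v) (sym eq) lt))

  cycleKey-injective : Injective _≡_ _≡_ (cycleKey σ)
  cycleKey-injective {u} {v} eq with Fin.<-cmp (cycleMin σ u) (cycleMin σ v)
  ... | tri< u<v _ _ = contradiction (sym eq) (<⇒≢ (cycleKey-cycleMin u<v))
  ... | tri> _ _ v<u = contradiction eq (<⇒≢ (cycleKey-cycleMin v<u))
  ... | tri≈ _ same-cycle _ = begin
    u                                       ≡⟨ σ^offset u ⟨
    (σ ^ offset σ u) (cycleMin σ u)         ≡⟨ cong₂ (λ j m → (σ ^ j) m) same-offset same-cycle ⟩
    (σ ^ offset σ v) (cycleMin σ v)         ≡⟨ σ^offset v ⟩
    v                                       ∎
    where
    open ≡-Reasoning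
    same-offset : offset σ u ≡ offset σ v
    same-offset = +-cancelˡ-≡ _ (offset σ u) (offset σ v)
                    (subst (λ m → (n ∸ toℕ m) * suc n + offset σ u ≡ cycleKey σ v) same-cycle eq)

  cycleKey-cycleMin-≤ : ∀ v → cycleKey σ (cycleMin σ v) ≤ cycleKey σ v
  cycleKey-cycleMin-≤ v = subst₂ (λ m o → (n ∸ toℕ m) * suc n + o ≤ cycleKey σ v)
    (sym (cycleMin-idem v)) (sym (offset-cycleMin v)) (+-monoʳ-≤ _ z≤n)

  cycleKey-≤⇒cycleMin-≥ : ∀ {u v} → cycleKey σ u ≤ cycleKey σ v → cycleMin σ v Fin.≤ cycleMin σ u
  cycleKey-≤⇒cycleMin-≥ le with m≤n⇒m<n∨m≡n le
  ... | inj₂ eq = ≤-reflexive (cong (toℕ ∘ cycleMin σ) (sym (cycleKey-injective eq)))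
  ... | inj₁ lt with cycleKey-<⁻ lt
  ...   | inj₁ v<u            = <⇒≤ v<u
  ...   | inj₂ (same , _)     = ≤-reflexive (cong toℕ (sym same))

  cycleKey-pred : ∀ {v} → 0 < offset σ v → ∃ λ u → σ u ≡ v × cycleKey σ v ≡ suc (cycleKey σ u)
  cycleKey-pred 0<offset = let (u , σu≡v , same-cycle , offset≡) = offset-pred 0<offset in
    u , σu≡v , cycleKey-suc same-cycle offset≡

  same-cycle-<⇒0<offset : ∀ {u v} → cycleMin σ u ≡ cycleMin σ v → cycleKey σ u < cycleKey σ v →
                          0 < offset σ v
  same-cycle-<⇒0<offset same-cycle lt with cycleKey-<⁻ lt
  ... | inj₁ v<u            = contradiction (cong toℕ same-cycle) (<⇒≢ v<u ∘ sym)
  ... | inj₂ (_ , u<v)      = <-≤-trans (s≤s z≤n) u<v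

-- Blocks of a word

module Blocks {n} (w : Vec (Fin n) n) where

  -- Past the end of the word, position p holds p itself, which keeps letter injective.
  letter : ℕ → ℕ
  letter p with p <? n
  ... | yes p<n = toℕ (lookup w (fromℕ< p<n))
  ... | no _    = p

  -- The last left-to-right minimum at or before p: where the block containing p begins.
  start : ℕ → ℕ
  start = argmin letter

  -- p + 1 is not a left-to-right minimum, so it stays in the block of p.
  Continues : ℕ → Set
  Continues p = suc p < n × start (suc p) ≡ start p

  start<n : ∀ {p} → p < n → start p < n
  start<n p<n = ≤-<-trans (argmin-≤ letter _) p<n

  blockStart : Fin n → Fin n
  blockStart q = fromℕ< (start<n (Fin.toℕ<n q))

  next : Fin n → Fin n
  next q with suc (toℕ q) <? n ×-dec start (suc (toℕ q)) ≟ start (toℕ q)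
  ... | yes (1+q<n , _) = fromℕ< 1+q<n
  ... | no _            = blockStart q

  letter-fromℕ< : ∀ {p} (p<n : p < n) → letter p ≡ toℕ (lookup w (fromℕ< p<n))
  letter-fromℕ< {p} p<n with p <? n
  ... | yes _   = refl
  ... | no p≮n = contradiction p<n p≮n

  letter-toℕ : ∀ q → letter (toℕ q) ≡ toℕ (lookup w q)
  letter-toℕ q = trans (letter-fromℕ< (Fin.toℕ<n q)) (cong (toℕ ∘ lookup w) (Fin.fromℕ<-toℕ q _))

  start-≤ : ∀ p → start p ≤ p
  start-≤ = argmin-≤ letter

  start-minimal : ∀ {p q} → q ≤ p → letter (start p) ≤ letter q
  start-minimal = argmin-minimal letter

  toℕ-blockStart : ∀ q → toℕ (blockStart q) ≡ start (toℕ q)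
  toℕ-blockStart q = Fin.toℕ-fromℕ< _

  next-cases : ∀ q → (Continues (toℕ q) × toℕ (next q) ≡ suc (toℕ q)) ⊎
                     (¬ Continues (toℕ q) × toℕ (next q) ≡ start (toℕ q))
  next-cases q with suc (toℕ q) <? n ×-dec start (suc (toℕ q)) ≟ start (toℕ q)
  ... | yes continues = inj₁ (continues , Fin.toℕ-fromℕ< _)
  ... | no stops      = inj₂ (stops , toℕ-blockStart q)

  next-continues : ∀ {q} → Continues (toℕ q) → toℕ (next q) ≡ suc (toℕ q)
  next-continues {q} continues with next-cases q
  ... | inj₁ (_ , eq)     = eq
  ... | inj₂ (stops , _)  = contradiction continues stops

  next-stops : ∀ {q} → ¬ Continues (toℕ q) → toℕ (next q) ≡ start (toℕ q)
  next-stops {q} stops with next-cases q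
  ... | inj₁ (continues , _) = contradiction continues stops
  ... | inj₂ (_ , eq)        = eq

  BlocksBounded : ℕ → Set
  BlocksBounded k = ∀ {p} → p < n → p < start p + k

  module _ (w-perm : IsPerm w) where

    letter-injective : Injective _≡_ _≡_ letter
    letter-injective {p} {q} eq with p <? n | q <? n
    ... | yes p<n | yes q<n = Fin.fromℕ<-injective p q p<n q<n (w-perm (Fin.toℕ-injective eq))
    ... | yes p<n | no q≮n  = contradiction (subst (_< n) eq (Fin.toℕ<n _)) q≮n
    ... | no p≮n  | yes q<n = contradiction (subst (_< n) (sym eq) (Fin.toℕ<n _)) p≮n
    ... | no _    | no _    = eq

    start-stable : ∀ {p q} → start p ≤ q → q ≤ p → start q ≡ start p
    start-stable {p} start≤q q≤p =
      argmin-unique letter-injective start≤q (λ r≤q → start-minimal (≤-trans r≤q q≤p))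

    start-idem : ∀ p → start (start p) ≡ start p
    start-idem p = start-stable ≤-refl (start-≤ p)

    start-monotone : ∀ {p q} → p ≤ q → start p ≤ start q
    start-monotone {p} {q} p≤q = ≮⇒≥ λ start-q<start-p →
      <-irrefl (sym (start-stable (≤-trans (<⇒≤ start-q<start-p) (start-≤ p)) p≤q)) start-q<start-p

    start-next : ∀ q → start (toℕ (next q)) ≡ start (toℕ q)
    start-next q with next-cases q
    ... | inj₁ ((_ , same) , eq) = trans (cong start eq) same
    ... | inj₂ (_ , eq)          = trans (cong start eq) (start-idem (toℕ q))

    start-next^ : ∀ m q → start (toℕ ((next ^ m) q)) ≡ start (toℕ q)
    start-next^ zero    q = refl
    start-next^ (suc m) q = trans (start-next ((next ^ m) q)) (start-next^ m q)

    private
      continues-≢-start : ∀ {p} → Continues p → ∀ r → suc p ≢ start r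
      continues-≢-start {p} (_ , same) r 1+p≡start = <-irrefl refl (begin-strict
        p               <⟨ n<1+n p ⟩
        suc p           ≡⟨ trans 1+p≡start (sym (start-idem r)) ⟩
        start (start r) ≡⟨ cong start 1+p≡start ⟨
        start (suc p)   ≡⟨ same ⟩
        start p         ≤⟨ start-≤ p ⟩
        p               ∎)
        where open ≤-Reasoning hiding (start)

      continues-within : ∀ {p q} → p < q → q < n → start p ≡ start q → Continues p
      continues-within {p} {q} p<q q<n same =
        ≤-<-trans p<q q<n ,
        trans (start-stable (≤-trans (≤-reflexive (sym same)) (≤-trans (start-≤ p) (n≤1+n p))) p<q) (sym same)

    next-injective : Injective _≡_ _≡_ next
    next-injective {p} {q} eq with next-cases p | next-cases q
    ... | inj₁ (_ , p↦) | inj₁ (_ , q↦) =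
      Fin.toℕ-injective (suc-injective (trans (sym p↦) (trans (cong toℕ eq) q↦)))
    ... | inj₁ (continues , p↦) | inj₂ (_ , q↦) =
      contradiction (trans (sym p↦) (trans (cong toℕ eq) q↦)) (continues-≢-start continues (toℕ q))
    ... | inj₂ (_ , p↦) | inj₁ (continues , q↦) =
      contradiction (trans (sym q↦) (trans (cong toℕ (sym eq)) p↦)) (continues-≢-start continues (toℕ p))
    ... | inj₂ (p-stops , p↦) | inj₂ (q-stops , q↦) with Fin.<-cmp p q
    ...   | tri< p<q _ _ = contradiction (continues-within p<q (Fin.toℕ<n q) same-start) p-stops
      where same-start = trans (sym p↦) (trans (cong toℕ eq) q↦)
    ...   | tri≈ _ p≡q _ = p≡q
    ...   | tri> _ _ q<p = contradiction (continues-within q<p (Fin.toℕ<n p) same-start) q-stops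
      where same-start = trans (sym q↦) (trans (cong toℕ (sym eq)) p↦)

    walk : ∀ q j → toℕ q + j < n → start (toℕ q + j) ≡ start (toℕ q) → toℕ ((next ^ j) q) ≡ toℕ q + j
    walk q zero    _ _ = sym (+-identityʳ (toℕ q))
    walk q (suc j) q+1+j<n same = begin
      toℕ (next ((next ^ j) q))   ≡⟨ next-continues continues ⟩
      suc (toℕ ((next ^ j) q))    ≡⟨ cong suc at-j ⟩
      suc (toℕ q + j)             ≡⟨ +-suc (toℕ q) j ⟨
      toℕ q + suc j               ∎
      where
      open ≡-Reasoning
      q+j≤q+1+j : toℕ q + j ≤ toℕ q + suc j
      q+j≤q+1+j = +-monoʳ-≤ (toℕ q) (n≤1+n j)
      same-j : start (toℕ q + j) ≡ start (toℕ q)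
      same-j = trans (start-stable (≤-trans (≤-reflexive same) (≤-trans (start-≤ (toℕ q)) (m≤m+n (toℕ q) j)))
                                   q+j≤q+1+j)
                     same
      at-j : toℕ ((next ^ j) q) ≡ toℕ q + j
      at-j = walk q j (≤-<-trans q+j≤q+1+j q+1+j<n) same-j
      continues : Continues (toℕ ((next ^ j) q))
      continues = subst (λ p → suc p < n × start (suc p) ≡ start p) (sym at-j)
        (subst (_< n) (+-suc (toℕ q) j) q+1+j<n ,
         trans (cong start (sym (+-suc (toℕ q) j))) (trans same (sym same-j)))

    walk-from-start : ∀ q {j} → j ≤ toℕ q ∸ start (toℕ q) →
                      toℕ ((next ^ j) (blockStart q)) ≡ start (toℕ q) + j
    walk-from-start q {j} j≤ = subst (λ t → toℕ ((next ^ j) (blockStart q)) ≡ t + j) (toℕ-blockStart q)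
      (walk (blockStart q) j (subst (λ t → t + j < n) (sym (toℕ-blockStart q)) (≤-<-trans s+j≤q (Fin.toℕ<n q)))
                             (subst (λ t → start (t + j) ≡ start t) (sym (toℕ-blockStart q)) same))
      where
      s = start (toℕ q)
      s+j≤q : s + j ≤ toℕ q
      s+j≤q = subst (s + j ≤_) (m+[n∸m]≡n (start-≤ (toℕ q))) (+-monoʳ-≤ s j≤)
      same : start (s + j) ≡ start s
      same = trans (start-stable (m≤m+n s j) s+j≤q) (sym (start-idem (toℕ q)))

    next^-blockStart : ∀ q → (next ^ (toℕ q ∸ start (toℕ q))) (blockStart q) ≡ q
    next^-blockStart q = Fin.toℕ-injective (trans (walk-from-start q ≤-refl) (m+[n∸m]≡n (start-≤ (toℕ q))))

    -- The orbit of q stays in its block, whose positions s, …, s + k - 1 label it by Fin k.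
    returnsWithin-next : ∀ {k} → BlocksBounded k → ∀ q → ReturnsWithin k next q
    returnsWithin-next {k} bounded q = returnsWithin-pigeonhole next-injective q idx idx-faithful
      where
      s = start (toℕ q)
      pos : ℕ → ℕ
      pos m = toℕ ((next ^ m) q)
      s≤pos : ∀ m → s ≤ pos m
      s≤pos m = subst (_≤ pos m) (start-next^ m q) (start-≤ (pos m))
      pos<s+k : ∀ m → pos m < s + k
      pos<s+k m = subst (λ t → pos m < t + k) (start-next^ m q) (bounded (Fin.toℕ<n _))
      idx : ℕ → Fin k
      idx m = fromℕ< (subst (pos m ∸ s <_) (m+n∸m≡n s k) (∸-monoˡ-< (pos<s+k m) (s≤pos m)))
      idx-faithful : ∀ i j → idx i ≡ idx j → (next ^ i) q ≡ (next ^ j) q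
      idx-faithful i j eq =
        Fin.toℕ-injective (∸-cancelʳ-≡ (s≤pos i) (s≤pos j) (Fin.fromℕ<-injective _ _ _ _ eq))

    long-block⇒¬returnsWithin : ∀ {k} q → start (toℕ q) + k ≤ toℕ q →
                                ¬ ReturnsWithin k next (blockStart q)
    long-block⇒¬returnsWithin {k} q long (ℓ , 1≤ℓ , ℓ≤k , returns) =
      <⇒≢ 1≤ℓ (sym (+-cancelˡ-≡ s ℓ 0 (begin
      s + ℓ                                 ≡⟨ walk-from-start q (≤-trans ℓ≤k (k≤q∸s)) ⟨
      toℕ ((next ^ ℓ) (blockStart q))       ≡⟨ cong toℕ returns ⟩
      toℕ (blockStart q)                    ≡⟨ toℕ-blockStart q ⟩
      s                                     ≡⟨ +-identityʳ s ⟨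
      s + 0                                 ∎)))
      where
      open ≡-Reasoning
      s = start (toℕ q)
      k≤q∸s : k ≤ toℕ q ∸ s
      k≤q∸s = m+n≤o⇒m≤o∸n k (subst (_≤ toℕ q) (+-comm s k) long)

    occurrence-of-long-block : ∀ {k p} → p < n → start p + k ≤ p → Occurrence k w
    occurrence-of-long-block {k} {p} p<n long =
      fromℕ< s<n , suc s , subst (_< suc s) (sym (Fin.toℕ-fromℕ< s<n)) (n<1+n s) ,
      ≤-trans (s≤s long) p<n , larger
      where
      s = start p
      s<n = start<n p<n
      larger : (t : ℕ) (lt : suc s + t < n) → t < k →
               toℕ (lookup w (fromℕ< s<n)) < toℕ (lookup w (fromℕ< lt))
      larger t lt t<k = subst₂ _<_ (letter-fromℕ< s<n) (letter-fromℕ< lt)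
        (≤∧≢⇒< (start-minimal (≤-trans (subst (_≤ s + k) (+-suc s t) (+-monoʳ-≤ s t<k)) long))
               (λ eq → <⇒≢ (s≤s (m≤m+n s t)) (letter-injective eq)))

    -- The letters at j, …, j + k exceed an earlier one, so the block of j + k starts before j.
    long-block-of-occurrence : ∀ {k} → Occurrence (suc k) w → ∃ λ p → p < n × start p + suc k ≤ p
    long-block-of-occurrence {k} (i , j , i<j , j+1+k≤n , larger) =
      j + k , e<n , subst (_≤ j + k) (sym (+-suc s k)) (+-monoˡ-≤ k s<j)
      where
      e<n : j + k < n
      e<n = <-≤-trans (+-monoʳ-< j (n<1+n k)) j+1+k≤n
      s = start (j + k)
      s<j : s < j
      s<j = ≰⇒> λ j≤s → <⇒≱ (in-window j≤s) (start-minimal (≤-trans (<⇒≤ i<j) (m≤m+n j k)))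
        where
        in-window : j ≤ s → letter (toℕ i) < letter s
        in-window j≤s = subst₂ _<_ (sym (letter-toℕ i))
                                   (trans (sym (letter-fromℕ< lt)) (cong letter (m+[n∸m]≡n j≤s)))
                          (larger (s ∸ j) lt t<1+k)
          where
          t<1+k : s ∸ j < suc k
          t<1+k = s≤s (m≤n+o⇒m∸n≤o s j (start-≤ (j + k)))
          lt : j + (s ∸ j) < n
          lt = subst (_< n) (sym (m+[n∸m]≡n j≤s)) (<-≤-trans (s≤s (start-≤ (j + k))) e<n)

    avoids⇒blocksBounded : ∀ {k} → ¬ Occurrence k w → BlocksBounded k
    avoids⇒blocksBounded avoids p<n = ≰⇒> (avoids ∘ occurrence-of-long-block p<n)

    blocksBounded⇒avoids : ∀ {k} → BlocksBounded (suc k) → ¬ Occurrence (suc k) w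
    blocksBounded⇒avoids bounded occurrence with p , p<n , long ← long-block-of-occurrence occurrence =
      <⇒≱ (bounded p<n) long

blockPerm : ∀ {n} → Vec (Fin n) n → Vec (Fin n) n
blockPerm w = tabulate (λ x → lookup w (Blocks.next w (inverse (lookup w) x)))

cycleWord : ∀ {n} → Vec (Fin n) n → Vec (Fin n) n
cycleWord σ = tabulate (listing (cycleKey (lookup σ)))

iter≡^ : ∀ {n} (σ : Vec (Fin n) n) m i → iter σ m i ≡ (lookup σ ^ m) i
iter≡^ σ zero    i = refl
iter≡^ σ (suc m) i = cong (lookup σ) (iter≡^ σ m i)

module _ {n} (w : Vec (Fin n) n) (w-perm : IsPerm w) where

  open Blocks w

  blockPerm-letter : ∀ q → lookup (blockPerm w) (lookup w q) ≡ lookup w (next q)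
  blockPerm-letter q = trans (lookup∘tabulate _ (lookup w q)) (cong (lookup w ∘ next) (inverseˡ w-perm q))

  blockPerm-^ : ∀ m q → (lookup (blockPerm w) ^ m) (lookup w q) ≡ lookup w ((next ^ m) q)
  blockPerm-^ zero    q = refl
  blockPerm-^ (suc m) q = trans (cong (lookup (blockPerm w)) (blockPerm-^ m q)) (blockPerm-letter _)

  blockPerm-isPerm : IsPerm (blockPerm w)
  blockPerm-isPerm {x} {y} eq = inverse-injective w-perm (next-injective w-perm (w-perm
    (trans (sym (lookup∘tabulate _ x)) (trans eq (lookup∘tabulate _ y)))))

  blockPerm-cycles : ∀ {k} → BlocksBounded k → ∀ x → CycleLen≤ k (blockPerm w) x
  blockPerm-cycles bounded x = cycle (returnsWithin-next w-perm bounded q)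
    where
    q = inverse (lookup w) x
    cycle : ∀ {k} → ReturnsWithin k next q → CycleLen≤ k (blockPerm w) x
    cycle (ℓ , 1≤ℓ , ℓ≤k , returns) = ℓ , 1≤ℓ , ℓ≤k ,
      trans (iter≡^ (blockPerm w) ℓ x) (trans (cong (lookup (blockPerm w) ^ ℓ) (sym (inverseʳ w-perm x)))
        (trans (blockPerm-^ ℓ q) (trans (cong (lookup w) returns) (inverseʳ w-perm x))))

  blockPerm-cycles⁻ : ∀ {k} → (∀ x → CycleLen≤ k (blockPerm w) x) → BlocksBounded k
  blockPerm-cycles⁻ cycles {p} p<n = ≰⇒> λ long →
    long-block⇒¬returnsWithin w-perm q (subst (λ t → start t + _ ≤ t) (sym (Fin.toℕ-fromℕ< p<n)) long)
      (returns (cycles (lookup w (blockStart q))))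
    where
    q = fromℕ< p<n
    returns : ∀ {k} → CycleLen≤ k (blockPerm w) (lookup w (blockStart q)) →
              ReturnsWithin k next (blockStart q)
    returns (ℓ , 1≤ℓ , ℓ≤k , cycle) =
      ℓ , 1≤ℓ , ℓ≤k , w-perm (trans (sym (blockPerm-^ ℓ (blockStart q)))
                             (trans (sym (iter≡^ (blockPerm w) ℓ (lookup w (blockStart q)))) cycle))

  private
    σ = lookup (blockPerm w)
    open CycleStructure blockPerm-isPerm

  cycleMin-blockPerm : ∀ q → cycleMin σ (lookup w q) ≡ lookup w (blockStart q)
  cycleMin-blockPerm q =
    cycleMin-char (reaches-symmetric blockPerm-isPerm (toℕ q ∸ start (toℕ q) , from-start)) least
    where
    from-start : (σ ^ (toℕ q ∸ start (toℕ q))) (lookup w (blockStart q)) ≡ lookup w q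
    from-start = trans (blockPerm-^ (toℕ q ∸ start (toℕ q)) (blockStart q))
                       (cong (lookup w) (next^-blockStart w-perm q))
    least : ∀ {y} → Reaches σ (lookup w q) y → lookup w (blockStart q) Fin.≤ y
    least (m , refl) = subst₂ _≤_
      (trans (cong letter (start-next^ w-perm m q)) (trans (cong letter (sym (toℕ-blockStart q))) (letter-toℕ _)))
      (trans (letter-toℕ _) (cong toℕ (sym (blockPerm-^ m q))))
      (start-minimal {toℕ ((next ^ m) q)} ≤-refl)

  offset-blockPerm : ∀ q → offset σ (lookup w q) ≡ toℕ q ∸ start (toℕ q)
  offset-blockPerm q = offset-char from-start earlier
    where
    s = start (toℕ q)
    from-start : (σ ^ (toℕ q ∸ s)) (cycleMin σ (lookup w q)) ≡ lookup w q
    from-start = trans (cong (σ ^ (toℕ q ∸ s)) (cycleMin-blockPerm q))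
                       (trans (blockPerm-^ (toℕ q ∸ s) (blockStart q)) (cong (lookup w) (next^-blockStart w-perm q)))
    earlier : ∀ {j} → j < toℕ q ∸ s → (σ ^ j) (cycleMin σ (lookup w q)) ≢ lookup w q
    earlier {j} j<q∸s eq = <⇒≢ (subst (s + j <_) (m+[n∸m]≡n (start-≤ (toℕ q))) (+-monoʳ-< s j<q∸s))
      (trans (sym (walk-from-start w-perm q (<⇒≤ j<q∸s)))
             (cong toℕ (w-perm (trans (sym (blockPerm-^ j (blockStart q)))
                                      (trans (cong (σ ^ j) (sym (cycleMin-blockPerm q))) eq)))))

  -- Block starts are left-to-right minima, so later blocks have smaller cycle minima.
  cycleKey-blockPerm-increasing : ∀ {p q} → p Fin.< q → cycleKey σ (lookup w p) < cycleKey σ (lookup w q)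
  cycleKey-blockPerm-increasing {p} {q} p<q with m≤n⇒m<n∨m≡n (start-monotone w-perm (<⇒≤ p<q))
  ... | inj₂ same-start = cycleKey-offset same-cycle
          (subst₂ _<_ (sym (offset-blockPerm p)) (sym (offset-blockPerm q))
            (subst (λ t → toℕ p ∸ start (toℕ p) < toℕ q ∸ t) same-start (∸-monoˡ-< p<q (start-≤ (toℕ p)))))
    where
    same-cycle : cycleMin σ (lookup w p) ≡ cycleMin σ (lookup w q)
    same-cycle = trans (cycleMin-blockPerm p) (trans (cong (lookup w) (Fin.toℕ-injective
      (trans (toℕ-blockStart p) (trans same-start (sym (toℕ-blockStart q)))))) (sym (cycleMin-blockPerm q)))
  ... | inj₁ earlier-start = cycleKey-cycleMin
          (subst₂ Fin._<_ (sym (cycleMin-blockPerm q)) (sym (cycleMin-blockPerm p))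
          (subst₂ _<_ (letter-toℕ (blockStart q)) (letter-toℕ (blockStart p)) later-start-smaller))
    where
    later-start-smaller : letter (toℕ (blockStart q)) < letter (toℕ (blockStart p))
    later-start-smaller = subst₂ (λ a b → letter a < letter b) (sym (toℕ-blockStart q)) (sym (toℕ-blockStart p))
      (≤∧≢⇒< (start-minimal (≤-trans (start-≤ (toℕ p)) (<⇒≤ p<q)))
             (λ eq → <⇒≢ earlier-start (sym (letter-injective w-perm eq))))

  cycleWord-blockPerm : cycleWord (blockPerm w) ≡ w
  cycleWord-blockPerm = begin
    tabulate (listing (cycleKey σ))  ≡⟨ tabulate-cong (λ q → sym (Ranking.increasing⇒≡listing cycleKey-injective
                                         (lookup w) cycleKey-blockPerm-increasing q)) ⟩
    tabulate (lookup w)              ≡⟨ tabulate∘lookup w ⟩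
    w                                ∎
    where open ≡-Reasoning

module _ {n} (σ : Vec (Fin n) n) (σ-perm : IsPerm σ) where

  private
    s = lookup σ
    key = cycleKey s
    w = cycleWord σ
    open CycleStructure σ-perm
    open Ranking cycleKey-injective
    open Blocks w

  lookup-cycleWord : ∀ p → lookup w p ≡ listing key p
  lookup-cycleWord = lookup∘tabulate (listing key)

  cycleWord-isPerm : IsPerm w
  cycleWord-isPerm {p} {q} eq = inverse-injective rank-injective
    (trans (sym (lookup-cycleWord p)) (trans eq (lookup-cycleWord q)))

  letter-cycleWord : ∀ p → letter (toℕ p) ≡ toℕ (listing key p)
  letter-cycleWord p = trans (letter-toℕ p) (cong toℕ (lookup-cycleWord p))

  start-cycleWord : ∀ p → start (toℕ p) ≡ toℕ (rank key (cycleMin s (listing key p)))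
  start-cycleWord p = argmin-unique (letter-injective cycleWord-isPerm) min≤p minimal
    where
    x = listing key p
    min≤p : toℕ (rank key (cycleMin s x)) ≤ toℕ p
    min≤p = subst (toℕ (rank key (cycleMin s x)) ≤_) (cong toℕ (rank-listing p)) (rank-≤ (cycleKey-cycleMin-≤ x))
    minimal : ∀ {q} → q ≤ toℕ p → letter (toℕ (rank key (cycleMin s x))) ≤ letter q
    minimal {q} q≤p = begin
      letter (toℕ (rank key (cycleMin s x)))       ≡⟨ letter-cycleWord _ ⟩
      toℕ (listing key (rank key (cycleMin s x)))  ≡⟨ cong toℕ (listing-rank _) ⟩
      toℕ (cycleMin s x)                           ≤⟨ cycleKey-≤⇒cycleMin-≥ (listing-monotone q′≤p) ⟩
      toℕ (cycleMin s y)                           ≤⟨ cycleMin-≤ y ⟩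
      toℕ y                                        ≡⟨ letter-cycleWord q′ ⟨
      letter (toℕ q′)                              ≡⟨ cong letter (Fin.toℕ-fromℕ< _) ⟩
      letter q                                     ∎
      where
      open ≤-Reasoning hiding (start)
      q′ = fromℕ< (≤-<-trans q≤p (Fin.toℕ<n p))
      q′≤p : q′ Fin.≤ p
      q′≤p = subst (_≤ toℕ p) (sym (Fin.toℕ-fromℕ< _)) q≤p
      y = listing key q′

  start-rank : ∀ v → start (toℕ (rank key v)) ≡ toℕ (rank key (cycleMin s v))
  start-rank v = trans (start-cycleWord (rank key v))
                       (cong (λ y → toℕ (rank key (cycleMin s y))) (listing-rank v))

  private
    same-start⇒same-cycle : ∀ {p q} → start (toℕ p) ≡ start (toℕ q) →
                            cycleMin s (listing key p) ≡ cycleMin s (listing key q)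
    same-start⇒same-cycle {p} {q} same = rank-injective (Fin.toℕ-injective
      (trans (sym (start-cycleWord p)) (trans same (start-cycleWord q))))

  cycle-continues : ∀ p → s (listing key p) ≢ cycleMin s (listing key p) →
                    listing key (next p) ≡ s (listing key p)
  cycle-continues p σx≢min = begin
    listing key (next p)          ≡⟨ cong (listing key) (Fin.toℕ-injective
                                       (trans (next-continues continues) (sym rank-σx))) ⟩
    listing key (rank key (s x))  ≡⟨ listing-rank (s x) ⟩
    s x                           ∎
    where
    open ≡-Reasoning
    x = listing key p
    rank-σx : toℕ (rank key (s x)) ≡ suc (toℕ p)
    rank-σx = trans (rank-suc (cycleKey-suc (sym (cycleMin-σ x)) (offset-σ σx≢min)))
                    (cong (suc ∘ toℕ) (rank-listing p))
    continues : Continues (toℕ p)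
    continues = subst (_< n) rank-σx (Fin.toℕ<n _) , (begin
      start (suc (toℕ p))                    ≡⟨ cong start rank-σx ⟨
      start (toℕ (rank key (s x)))           ≡⟨ start-rank (s x) ⟩
      toℕ (rank key (cycleMin s (s x)))      ≡⟨ cong (toℕ ∘ rank key) (cycleMin-σ x) ⟩
      toℕ (rank key (cycleMin s x))          ≡⟨ start-cycleWord p ⟨
      start (toℕ p)                          ∎)

  -- If p continued, the next letter y would lie in the cycle of x at positive offset,
  -- so its predecessor in the cycle would be the letter x before it: y = σ x = cycleMin y.
  cycle-closes : ∀ p → s (listing key p) ≡ cycleMin s (listing key p) → ¬ Continues (toℕ p)
  cycle-closes p σx≡min (1+p<n , same) =
    <⇒≢ 0<offset-y (sym (trans (cong (offset s) y≡min) (offset-cycleMin y)))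
    where
    x = listing key p
    p′ = fromℕ< 1+p<n
    y = listing key p′
    same-cycle : cycleMin s x ≡ cycleMin s y
    same-cycle = same-start⇒same-cycle (trans (sym same) (cong start (sym (Fin.toℕ-fromℕ< 1+p<n))))
    0<offset-y : 0 < offset s y
    0<offset-y = same-cycle-<⇒0<offset same-cycle
      (listing-increasing (subst (toℕ p <_) (sym (Fin.toℕ-fromℕ< 1+p<n)) (n<1+n (toℕ p))))
    y≡min : y ≡ cycleMin s y
    y≡min = let (u , σu≡y , key≡) = cycleKey-pred 0<offset-y
                rank-u≡p : toℕ (rank key u) ≡ toℕ p
                rank-u≡p = suc-injective (trans (sym (rank-suc key≡))
                             (trans (cong toℕ (rank-listing p′)) (Fin.toℕ-fromℕ< 1+p<n)))
                u≡x = trans (sym (listing-rank u)) (cong (listing key) (Fin.toℕ-injective rank-u≡p))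
            in trans (sym σu≡y) (trans (cong s u≡x) (trans σx≡min same-cycle))

  next-cycleWord : ∀ p → listing key (next p) ≡ s (listing key p)
  next-cycleWord p = by-cases (s x Fin.≟ cycleMin s x)
    where
    open ≡-Reasoning
    x = listing key p
    by-cases : Dec (s x ≡ cycleMin s x) → listing key (next p) ≡ s x
    by-cases (no σx≢min) = cycle-continues p σx≢min
    by-cases (yes σx≡min) = begin
      listing key (next p)                    ≡⟨ cong (listing key) (Fin.toℕ-injective
                                                   (trans (next-stops (cycle-closes p σx≡min)) (start-cycleWord p))) ⟩
      listing key (rank key (cycleMin s x))   ≡⟨ listing-rank (cycleMin s x) ⟩
      cycleMin s x                            ≡⟨ σx≡min ⟨
      s x                                     ∎

  blockPerm-cycleWord : blockPerm (cycleWord σ) ≡ σ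
  blockPerm-cycleWord = trans (tabulate-cong next-letter) (tabulate∘lookup σ)
    where
    next-letter : ∀ x → lookup w (next (inverse (lookup w) x)) ≡ s x
    next-letter x = trans (lookup-cycleWord _) (trans (next-cycleWord _)
      (cong s (trans (sym (lookup-cycleWord _)) (inverseʳ cycleWord-isPerm x))))

mainTheorem1 : (k n : ℕ) → k ≥ 1 → Bijection (CycleBoundedSetoid k n) (AvoidingSetoid k n)
mainTheorem1 (suc k) n _ = record
  { to        = toAvoider
  ; cong      = cong cycleWord
  ; bijective = (λ {x y} → injective {x} {y}) , surjective
  }
  where
  toAvoider : CycleBounded (suc k) n → AvoidingPerms (suc k) n
  toAvoider ((σ , σ-perm) , cycles) = (cycleWord σ , w-perm) ,
    Blocks.blocksBounded⇒avoids (cycleWord σ) w-perm (blockPerm-cycles⁻ (cycleWord σ) w-perm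
      (subst (λ τ → ∀ x → CycleLen≤ (suc k) τ x) (sym (blockPerm-cycleWord σ σ-perm)) cycles))
    where
    w-perm : IsPerm (cycleWord σ)
    w-perm = cycleWord-isPerm σ σ-perm

  injective : ∀ {x y} → word (toAvoider x) ≡ word (toAvoider y) → word x ≡ word y
  injective {(σ , σ-perm) , _} {(τ , τ-perm) , _} same-word = begin
    σ                          ≡⟨ blockPerm-cycleWord σ σ-perm ⟨
    blockPerm (cycleWord σ)    ≡⟨ cong blockPerm same-word ⟩
    blockPerm (cycleWord τ)    ≡⟨ blockPerm-cycleWord τ τ-perm ⟩
    τ                          ∎
    where open ≡-Reasoning

  surjective : ∀ y → ∃ λ x → ∀ {z} → word z ≡ word x → word (toAvoider z) ≡ word y
  surjective ((w , w-perm) , avoids) =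
    ((blockPerm w , blockPerm-isPerm w w-perm) ,
     blockPerm-cycles w w-perm (Blocks.avoids⇒blocksBounded w w-perm avoids)) ,
    λ same-word → trans (cong cycleWord same-word) (cycleWord-blockPerm w w-perm)
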